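{- Let $\mathsf{Pred}$ be a finite set of unary predicates, $S_1,\dots,S_n$ pairwise distinct state-descriptions over $\mathsf{Pred}$, and consider a Diophantine inequality $m_1(\mathbf{v})+\dots+m_k(\mathbf{v})\ge m'_1(\mathbf{v})+\dots+m'_j(\mathbf{v})$ in variables $\mathbf{v}=\mathsf{v}_1,\dots,\mathsf{v}_n$, where each $m_i,m'_i$ is a monomial $a\,\mathsf{v}_1^{e_1}\cdots\mathsf{v}_n^{e_n}$ with $a,e_1,\dots,e_n$ natural numbers and $a>0$. Then there is an $\mathcal{L}^1_\sharp$ sentence $\varphi$ in the predicates $\mathsf{Pred}$ such that for every finite model $\mathcal{M}$, $\mathcal{M}\models\varphi$ iff the values $\mathsf{v}_i=|S_i|_\mathcal{M}$ ($i\le n$) satisfy the inequality. That is, every Diophantine inequality can be expressed in $\mathsf{MFO}^\phi(\sharp)$.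
   Context: $\mathcal{L}^1_\sharp$ is monadic first-order logic with equality over unary predicates, closed under Booleans, first-order quantifiers and polyadic count comparisons $\sharp_{\mathbf{x}}\varphi\succsim\sharp_{\mathbf{y}}\psi$, where $\mathbf{x}=x_1,\dots,x_n$ and $\mathbf{y}=y_1,\dots,y_m$ are finite sequences of variables (possibly of different lengths, arbitrarily nested). In a model with domain $D$ and assignment $s$, $\sharp_{\mathbf{x}}\varphi\succsim\sharp_{\mathbf{y}}\psi$ holds iff $|\{\mathbf{d}\in D^n: s[\mathbf{x}\mapsto\mathbf{d}]\text{ satisfies }\varphi\}|\ge|\{\mathbf{d}\in D^m: s[\mathbf{y}\mapsto\mathbf{d}]\text{ satisfies }\psi\}|$. $\mathsf{MFO}^\phi(\sharp)$ is this logic over finite models. A state-description over $\mathsf{Pred}$ is $\bigwedge_{P\in J}P(x)\wedge\bigwedge_{P\notin J}\neg P(x)$, $J\subseteq\mathsf{Pred}$; $|S|_\mathcal{M}$ is the cardinality of its extension in $\mathcal{M}$. -}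

module Defs where

open import Data.Nat using (ℕ; zero; suc; _+_; _*_; _^_; _≤ᵇ_; _≡ᵇ_)
open import Data.Bool using (Bool; true; false; not; _∧_; if_then_else_)
open import Data.Fin using (Fin)
open import Data.Fin.Properties using () renaming (_≟_ to _≟F_)
open import Data.Fin.Subset using (Subset)
open import Data.List using (List; []; _∷_; map)
open import Data.Nat.ListAction using (sum)
open import Data.Bool.ListAction using (any; all)
open import Data.Fin.Base using () renaming (zero to fzero)
open import Data.List using (allFin)
open import Data.Vec using (Vec; lookup; foldr; tabulate)
open import Relation.Nullary.Decidable using (⌊_⌋)

Var : Set
Var = ℕ

data Formula (p : ℕ) : Set where
  atom   : Fin p → Var → Formula p
  equal  : Var → Var → Formula p
  neg    : Formula p → Formula p
  conj   : Formula p → Formula p → Formula p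
  disj   : Formula p → Formula p → Formula p
  exists : Var → Formula p → Formula p
  all∀ : Var → Formula p → Formula p
  count≿ : List Var → Formula p → List Var → Formula p → Formula p

remove : Var → List Var → List Var
remove x [] = []
remove x (y ∷ ys) = if y ≡ᵇ x then remove x ys else y ∷ remove x ys

removeAll : List Var → List Var → List Var
removeAll [] vs = vs
removeAll (x ∷ xs) vs = removeAll xs (remove x vs)

fv : ∀ {p} → Formula p → List Var
fv (atom P x) = x ∷ []
fv (equal x y) = x ∷ y ∷ []
fv (neg φ) = fv φ
fv (conj φ ψ) = fv φ Data.List.++ fv ψ
fv (disj φ ψ) = fv φ Data.List.++ fv ψ
fv (exists x φ) = remove x (fv φ)
fv (all∀ x φ) = remove x (fv φ)
fv (count≿ xs φ ys ψ) = removeAll xs (fv φ) Data.List.++ removeAll ys (fv ψ)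

Sentence : ∀ {p} → Formula p → Set
Sentence φ = fv φ ≡ [] where open import Relation.Binary.PropositionalEquality using (_≡_)

record Model (p : ℕ) : Set where
  field
    size   : ℕ
    interp : Fin p → Fin (suc size) → Bool

Dom : ∀ {p} → Model p → Set
Dom M = Fin (suc (Model.size M))

Assignment : ∀ {p} → Model p → Set
Assignment M = Var → Dom M

_[_↦_] : ∀ {p} {M : Model p} → Assignment M → Var → Dom M → Assignment M
(s [ x ↦ d ]) y = if y ≡ᵇ x then d else s y

countTuples : ∀ {p} (M : Model p) → (Assignment M → Bool) → List Var → Assignment M → ℕ
countTuples M t [] s = if t s then 1 else 0
countTuples M t (x ∷ xs) s =
  sum (map (λ d → countTuples M t xs (_[_↦_] {M = M} s x d)) (allFin (suc (Model.size M))))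

eval : ∀ {p} (M : Model p) → Formula p → Assignment M → Bool
eval M (atom P x) s = Model.interp M P (s x)
eval M (equal x y) s = ⌊ s x ≟F s y ⌋
eval M (neg φ) s = not (eval M φ s)
eval M (conj φ ψ) s = eval M φ s ∧ eval M ψ s
eval M (disj φ ψ) s = eval M φ s Data.Bool.∨ eval M ψ s
eval M (exists x φ) s =
  any (λ d → eval M φ (_[_↦_] {M = M} s x d)) (allFin (suc (Model.size M)))
eval M (all∀ x φ) s =
  all (λ d → eval M φ (_[_↦_] {M = M} s x d)) (allFin (suc (Model.size M)))
eval M (count≿ xs φ ys ψ) s =
  countTuples M (eval M ψ) ys s ≤ᵇ countTuples M (eval M φ) xs s

-- Truth of a sentence (assignment irrelevant; we use the constant one).
_⊨_ : ∀ {p} (M : Model p) → Formula p → Set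
M ⊨ φ = eval M φ (λ _ → fzero) ≡ true
  where open import Relation.Binary.PropositionalEquality using (_≡_)

-- State-description for J ⊆ Pred, in variable x:
-- ⋀_{P∈J} P(x) ∧ ⋀_{P∉J} ¬P(x)  (as a conjunction over all P, with ⊤ := x = x).
stateDesc : ∀ {p} → Subset p → Var → Formula p
stateDesc {p} J x = foldr _ conj (equal x x)
  (tabulate (λ P → if lookup J P then atom P x else neg (atom P x)))

card : ∀ {p} (M : Model p) → Subset p → ℕ
card M J = countTuples M (eval M (stateDesc J 0)) (0 ∷ []) (λ _ → fzero)

-- Monomial a · v_1^{e_1} ⋯ v_n^{e_n}  (positivity of a imposed in the theorem).
record Monomial (n : ℕ) : Set where
  field
    coeff : ℕ
    exps  : Vec ℕ n

evalMon : ∀ {n} → Monomial n → (Fin n → ℕ) → ℕ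
evalMon {n} m v =
  Monomial.coeff m * foldr _ _*_ 1 (tabulate (λ i → v i ^ lookup (Monomial.exps m) i))

sumMon : ∀ {n k} → Vec (Monomial n) k → (Fin n → ℕ) → ℕ
sumMon ms v = foldr _ _+_ 0 (Data.Vec.map (λ m → evalMon m v) ms)

{-# OPTIONS --safe #-}
module Submission where

-- In a model with two distinct elements a and b, counting tuples does arithmetic on the
-- cardinalities |S|: ♯_{x,ȳ}(S(x) ∧ ψ) = |S| · ♯_ȳ ψ, and ♯_{x,ȳ}((x = a ∧ ψ) ∨ (x = b ∧ χ))
-- = ♯_ȳ ψ + ♯_ȳ χ, while a conjunct x = a pads a tuple without changing its count. So each
-- side of the inequality is the count of one formula with free variables a, b, and
-- ∃a ∃b (a ≠ b ∧ ♯ ≿ ♯) expresses the inequality. In a one-element model each |S_i| is 0 or 1,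
-- namely the truth value of ∃x S_i(x), so there the inequality is a Boolean combination of
-- these sentences.

open import Defs
open import Data.Bool using (Bool; true; false; not; _∧_; _∨_; if_then_else_; T)
open import Data.Bool.Properties using (∨-identityʳ; T-≡; T-∧; if-cong₂)
open import Data.Empty using (⊥; ⊥-elim)
open import Data.Fin using (Fin; zero; suc)
open import Data.Fin.Properties using () renaming (_≟_ to _≟ᶠ_)
open import Data.Fin.Subset using (Subset)
open import Data.List using (List; []; _∷_; map; allFin)
open import Data.List.Membership.Propositional using (_∈_; lose)
open import Data.List.Membership.Propositional.Properties using (∈-allFin)
open import Data.List.Properties using (map-cong; map-tabulate)
open import Data.List.Relation.Unary.All as Allˡ using ([]; _∷_) renaming (All to Allˡ)
open import Data.List.Relation.Unary.All.Properties using (++⁺)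
open import Data.List.Relation.Unary.Any using (here; there; satisfied)
open import Data.List.Relation.Unary.Any.Properties using (any⁺; any⁻)
open import Data.Nat using (ℕ; zero; suc; _+_; _*_; _^_; _≤_; _<_; _≤ᵇ_; _≡ᵇ_; _⊔_; z≤n; s≤s)
open import Data.Nat.ListAction using (sum)
open import Data.Nat.Properties
  using (_≟_; +-commutativeSemigroup; +-identityʳ; *-identityˡ; *-assoc; *-distribʳ-+;
         ≤-refl; ≤-trans; <-trans; n≤1+n; m≤n⇒m≤1+n; m≤m⊔n; m≤n⊔m; <⇒≢; ≤ᵇ⇒≤; ≤⇒≤ᵇ;
         n<1⇒n≡0; m<1+n⇒m<n∨m≡n)
open import Data.Product using (Σ; _×_; _,_)
open import Data.Sum as Sum using (_⊎_; inj₁; inj₂; swap; fromInj₂)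
open import Data.Vec using (Vec; lookup) renaming ([] to []ᵛ; _∷_ to _∷ᵛ_)
import Data.Vec as Vec
open import Data.Vec.Properties using (lookup∘tabulate; tabulate-cong)
open import Data.Vec.Relation.Unary.All using (All)
open import Function using (_∘_; id; _⇔_; mk⇔; Equivalence)
open import Function.Properties.Equivalence using () renaming (sym to ⇔-sym; trans to ⇔-trans)
open import Relation.Nullary.Decidable
  using (⌊_⌋; yes; no; dec-true; dec-false; toWitnessFalse; fromWitnessFalse)
open import Relation.Binary.PropositionalEquality

open ≡-Reasoning
open Equivalence using (to; from)
open import Algebra.Properties.CommutativeSemigroup +-commutativeSemigroup using (interchange)

indicator : Bool → ℕ
indicator b = if b then 1 else 0

module _ {A : Set} where

  sum-map-+ : (f g : A → ℕ) (xs : List A) →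
    sum (map (λ x → f x + g x) xs) ≡ sum (map f xs) + sum (map g xs)
  sum-map-+ f g [] = refl
  sum-map-+ f g (x ∷ xs) = begin
    f x + g x + sum (map (λ x → f x + g x) xs)     ≡⟨ cong (f x + g x +_) (sum-map-+ f g xs) ⟩
    f x + g x + (sum (map f xs) + sum (map g xs))  ≡⟨ interchange (f x) (g x) _ _ ⟩
    f x + sum (map f xs) + (g x + sum (map g xs))  ∎

  sum-map-*ʳ : (f : A → ℕ) (c : ℕ) (xs : List A) →
    sum (map (λ x → f x * c) xs) ≡ sum (map f xs) * c
  sum-map-*ʳ f c [] = refl
  sum-map-*ʳ f c (x ∷ xs) =
    trans (cong (f x * c +_) (sum-map-*ʳ f c xs)) (sym (*-distribʳ-+ c (f x) _))

  sum-map-0 : (xs : List A) → sum (map (λ _ → 0) xs) ≡ 0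
  sum-map-0 [] = refl
  sum-map-0 (x ∷ xs) = sum-map-0 xs

sum-map-allFin-suc : ∀ {m} (f : Fin (suc m) → ℕ) →
  sum (map f (allFin (suc m))) ≡ f zero + sum (map (f ∘ suc) (allFin m))
sum-map-allFin-suc f =
  cong (λ ys → f zero + sum ys) (trans (map-tabulate suc f) (sym (map-tabulate id (f ∘ suc))))

≟ᶠ-suc : ∀ {m} (x y : Fin m) → ⌊ suc x ≟ᶠ suc y ⌋ ≡ ⌊ x ≟ᶠ y ⌋
≟ᶠ-suc x y with x ≟ᶠ y
... | yes _ = refl
... | no _ = refl

sum-indicator-≟ : ∀ {m} (c : Fin m) → sum (map (λ d → indicator ⌊ d ≟ᶠ c ⌋) (allFin m)) ≡ 1
sum-indicator-≟ {suc m} zero =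
  trans (sum-map-allFin-suc {m} (λ d → indicator ⌊ d ≟ᶠ zero ⌋)) (cong suc (sum-map-0 (allFin m)))
sum-indicator-≟ {suc m} (suc c) = begin
  sum (map (λ d → indicator ⌊ d ≟ᶠ suc c ⌋) (allFin (suc m)))
    ≡⟨ sum-map-allFin-suc (λ d → indicator ⌊ d ≟ᶠ suc c ⌋) ⟩
  sum (map (λ d → indicator ⌊ suc d ≟ᶠ suc c ⌋) (allFin m))
    ≡⟨ cong sum (map-cong (λ d → cong indicator (≟ᶠ-suc d c)) (allFin m)) ⟩
  sum (map (λ d → indicator ⌊ d ≟ᶠ c ⌋) (allFin m))
    ≡⟨ sum-indicator-≟ c ⟩
  1 ∎

≟ᶠ-exclusive : ∀ {m} (d a b : Fin m) → a ≢ b → ⌊ d ≟ᶠ a ⌋ ∧ ⌊ d ≟ᶠ b ⌋ ≡ false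
≟ᶠ-exclusive d a b a≢b with d ≟ᶠ a | d ≟ᶠ b
... | yes refl | yes refl = ⊥-elim (a≢b refl)
... | yes _    | no _     = refl
... | no _     | _        = refl

≡ᵇ-refl : ∀ x → (x ≡ᵇ x) ≡ true
≡ᵇ-refl x = dec-true (x ≟ x) refl

≢⇒≡ᵇ≡false : ∀ {x y} → x ≢ y → (x ≡ᵇ y) ≡ false
≢⇒≡ᵇ≡false {x} {y} = dec-false (x ≟ y)

-- Closed, and true by computation because domains are nonempty.
⊤ᶠ ⊥ᶠ : ∀ {p} → Formula p
⊤ᶠ = exists 0 (equal 0 0)
⊥ᶠ = neg ⊤ᶠ

ite : ∀ {p} → Formula p → Formula p → Formula p → Formula p
ite c φ ψ = disj (conj c φ) (conj (neg c) ψ)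

eval-ite : ∀ {p} (M : Model p) c φ ψ s →
  eval M (ite c φ ψ) s ≡ (if eval M c s then eval M φ s else eval M ψ s)
eval-ite M c φ ψ s with eval M c s
... | true  = ∨-identityʳ _
... | false = refl

module _ {p : ℕ} (Q : (Var → Formula p) → Set)
         (Q-refl : Q (λ x → equal x x))
         (Q-atom : ∀ P → Q (atom P))
         (Q-neg  : ∀ {F} → Q F → Q (λ x → neg (F x)))
         (Q-conj : ∀ {F G} → Q F → Q G → Q (λ x → conj (F x) (G x))) where

  stateDesc-induction : (J : Subset p) → Q (stateDesc J)
  stateDesc-induction J = conjunction (λ P x → if lookup J P then atom P x else neg (atom P x)) literal
    where
    literal : ∀ P → Q (λ x → if lookup J P then atom P x else neg (atom P x))
    literal P with lookup J P
    ... | true  = Q-atom P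
    ... | false = Q-neg (Q-atom P)

    conjunction : ∀ {q} (F : Fin q → Var → Formula p) → (∀ i → Q (F i)) →
      Q (λ x → Vec.foldr _ conj (equal x x) (Vec.tabulate (λ i → F i x)))
    conjunction {zero}  F QF = Q-refl
    conjunction {suc q} F QF = Q-conj (QF zero) (conjunction (F ∘ suc) (QF ∘ suc))

All-remove : ∀ {P : Var → Set} x ys → Allˡ (λ y → y ≡ x ⊎ P y) ys → Allˡ P (remove x ys)
All-remove x [] [] = []
All-remove x (y ∷ ys) (py ∷ pys) with y ≟ x
... | yes refl rewrite ≡ᵇ-refl y = All-remove x ys pys
... | no y≢x rewrite ≢⇒≡ᵇ≡false y≢x = fromInj₂ (⊥-elim ∘ y≢x) py ∷ All-remove x ys pys

All-removeAll : ∀ {P : Var → Set} xs ys → Allˡ (λ y → y ∈ xs ⊎ P y) ys → Allˡ P (removeAll xs ys)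
All-removeAll []       ys pys = Allˡ.map (fromInj₂ λ ()) pys
All-removeAll {P} (x ∷ xs) ys pys = All-removeAll xs (remove x ys) (All-remove x ys (Allˡ.map shift pys))
  where
  shift : ∀ {y} → y ∈ x ∷ xs ⊎ P y → y ≡ x ⊎ (y ∈ xs ⊎ P y)
  shift (inj₁ (here y≡x))  = inj₁ y≡x
  shift (inj₁ (there y∈xs)) = inj₂ (inj₁ y∈xs)
  shift (inj₂ Py)          = inj₂ (inj₂ Py)

fv-stateDesc : ∀ {p} (J : Subset p) x → Allˡ (_≡ x) (fv (stateDesc J x))
fv-stateDesc J = stateDesc-induction (λ F → ∀ x → Allˡ (_≡ x) (fv (F x)))
  (λ x → refl ∷ refl ∷ []) (λ P x → refl ∷ []) id (λ QF QG x → ++⁺ (QF x) (QG x)) J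

fv-ite : ∀ {p} {P : Var → Set} (c φ ψ : Formula p) →
  Allˡ P (fv c) → Allˡ P (fv φ) → Allˡ P (fv ψ) → Allˡ P (fv (ite c φ ψ))
fv-ite c φ ψ Pc Pφ Pψ = ++⁺ (++⁺ Pc Pφ) (++⁺ Pc Pψ)

Closed : ∀ {p} → Formula p → Set
Closed φ = Allˡ (λ _ → ⊥) (fv φ)

Closed⇒Sentence : ∀ {p} {φ : Formula p} → Closed φ → Sentence φ
Closed⇒Sentence {φ = φ} closed with fv φ | closed
... | [] | [] = refl

module Counting {p : ℕ} (M : Model p) where

  Asg : Set
  Asg = Assignment M

  _[_≔_] : Asg → Var → Dom M → Asg
  s [ x ≔ d ] = _[_↦_] {M = M} s x d

  domain : List (Dom M)
  domain = allFin (suc (Model.size M))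

  update-≡ : ∀ s x d → (s [ x ≔ d ]) x ≡ d
  update-≡ s x d rewrite ≡ᵇ-refl x = refl

  update-≢ : ∀ s {x y} d → y ≢ x → (s [ x ≔ d ]) y ≡ s y
  update-≢ s d y≢x rewrite ≢⇒≡ᵇ≡false y≢x = refl

  Ignores : (Asg → Bool) → Var → Set
  Ignores t x = ∀ s d → t (s [ x ≔ d ]) ≡ t s

  ignores-equal : ∀ {x y w} → x ≢ w → y ≢ w → Ignores (eval M (equal x y)) w
  ignores-equal x≢w y≢w s d = cong₂ (λ a b → ⌊ a ≟ᶠ b ⌋) (update-≢ s d x≢w) (update-≢ s d y≢w)

  Local : (Var → Formula p) → Set
  Local F = ∀ {x y} {s s' : Asg} → s x ≡ s' y → eval M (F x) s ≡ eval M (F y) s'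

  local-stateDesc : ∀ J → Local (stateDesc J)
  local-stateDesc = stateDesc-induction Local
    (λ sx≡s'y → cong (λ a → ⌊ a ≟ᶠ a ⌋) sx≡s'y)
    (λ P sx≡s'y → cong (Model.interp M P) sx≡s'y)
    (λ LF sx≡s'y → cong not (LF sx≡s'y))
    (λ LF LG sx≡s'y → cong₂ _∧_ (LF sx≡s'y) (LG sx≡s'y))

  ignores-stateDesc : ∀ J {x w} → x ≢ w → Ignores (eval M (stateDesc J x)) w
  ignores-stateDesc J x≢w s d = local-stateDesc J (update-≢ s d x≢w)

  countTuples-cong : ∀ {t t' : Asg → Bool} → (∀ s → t s ≡ t' s) →
    ∀ xs s → countTuples M t xs s ≡ countTuples M t' xs s
  countTuples-cong t≗t' []       s = cong indicator (t≗t' s)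
  countTuples-cong t≗t' (x ∷ xs) s =
    cong sum (map-cong (λ d → countTuples-cong t≗t' xs (s [ x ≔ d ])) domain)

  countTuples-false : ∀ xs s → countTuples M (λ _ → false) xs s ≡ 0
  countTuples-false []       s = refl
  countTuples-false (x ∷ xs) s =
    trans (cong sum (map-cong (λ d → countTuples-false xs (s [ x ≔ d ])) domain)) (sum-map-0 domain)

  countTuples-freeze : (a : Asg → Bool) (t : Bool → Asg → Bool) → ∀ xs → Allˡ (Ignores a) xs →
    ∀ s → countTuples M (λ s' → t (a s') s') xs s ≡ countTuples M (t (a s)) xs s
  countTuples-freeze a t []       []         s = refl
  countTuples-freeze a t (x ∷ xs) (ign ∷ igns) s = cong sum (map-cong frozen domain)
    where
    frozen : ∀ d → countTuples M (λ s' → t (a s') s') xs (s [ x ≔ d ])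
                 ≡ countTuples M (t (a s)) xs (s [ x ≔ d ])
    frozen d = trans (countTuples-freeze a t xs igns (s [ x ≔ d ]))
                     (cong (λ b → countTuples M (t b) xs (s [ x ≔ d ])) (ign s d))

  countTuples-∧ : ∀ b (t : Asg → Bool) xs s →
    countTuples M (λ s' → b ∧ t s') xs s ≡ indicator b * countTuples M t xs s
  countTuples-∧ true  t xs s = sym (+-identityʳ _)
  countTuples-∧ false t xs s = countTuples-false xs s

  countTuples-select : ∀ a b → a ∧ b ≡ false → ∀ (t r : Asg → Bool) xs s →
    countTuples M (λ s' → (a ∧ t s') ∨ (b ∧ r s')) xs s
      ≡ indicator a * countTuples M t xs s + indicator b * countTuples M r xs s
  countTuples-select true  false _ t r xs s =
    trans (countTuples-cong (λ s' → ∨-identityʳ (t s')) xs s)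
          (sym (trans (+-identityʳ _) (+-identityʳ _)))
  countTuples-select false true  _ t r xs s = sym (+-identityʳ _)
  countTuples-select false false _ t r xs s = countTuples-false xs s

  countTuples-conj : ∀ (G φ : Formula p) v xs s {X} → Allˡ (Ignores (eval M G)) xs →
    (∀ d → countTuples M (eval M φ) xs (s [ v ≔ d ]) ≡ X) →
    countTuples M (eval M (conj G φ)) (v ∷ xs) s ≡ countTuples M (eval M G) (v ∷ []) s * X
  countTuples-conj G φ v xs s {X} igns φ≡X =
    trans (cong sum (map-cong summand domain)) (sum-map-*ʳ (λ d → indicator (g d)) X domain)
    where
    g : Dom M → Bool
    g d = eval M G (s [ v ≔ d ])

    summand : ∀ d → countTuples M (eval M (conj G φ)) xs (s [ v ≔ d ]) ≡ indicator (g d) * X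
    summand d = begin
      countTuples M (eval M (conj G φ)) xs (s [ v ≔ d ])
        ≡⟨ countTuples-freeze (eval M G) (λ b s' → b ∧ eval M φ s') xs igns (s [ v ≔ d ]) ⟩
      countTuples M (λ s' → g d ∧ eval M φ s') xs (s [ v ≔ d ])
        ≡⟨ countTuples-∧ (g d) (eval M φ) xs (s [ v ≔ d ]) ⟩
      indicator (g d) * countTuples M (eval M φ) xs (s [ v ≔ d ])
        ≡⟨ cong (indicator (g d) *_) (φ≡X d) ⟩
      indicator (g d) * X ∎

  countTuples-disj : ∀ (G H φ ψ : Formula p) v xs s {X Y} →
    Allˡ (Ignores (eval M G)) xs → Allˡ (Ignores (eval M H)) xs →
    (∀ d → eval M G (s [ v ≔ d ]) ∧ eval M H (s [ v ≔ d ]) ≡ false) →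
    (∀ d → countTuples M (eval M φ) xs (s [ v ≔ d ]) ≡ X) →
    (∀ d → countTuples M (eval M ψ) xs (s [ v ≔ d ]) ≡ Y) →
    countTuples M (eval M (disj (conj G φ) (conj H ψ))) (v ∷ xs) s
      ≡ countTuples M (eval M G) (v ∷ []) s * X + countTuples M (eval M H) (v ∷ []) s * Y
  countTuples-disj G H φ ψ v xs s {X} {Y} ignsG ignsH exclusive φ≡X ψ≡Y = begin
    sum (map (λ d → countTuples M (eval M (disj (conj G φ) (conj H ψ))) xs (s [ v ≔ d ])) domain)
      ≡⟨ cong sum (map-cong summand domain) ⟩
    sum (map (λ d → indicator (g d) * X + indicator (h d) * Y) domain)
      ≡⟨ sum-map-+ (λ d → indicator (g d) * X) (λ d → indicator (h d) * Y) domain ⟩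
    sum (map (λ d → indicator (g d) * X) domain) + sum (map (λ d → indicator (h d) * Y) domain)
      ≡⟨ cong₂ _+_ (sum-map-*ʳ (λ d → indicator (g d)) X domain)
                   (sum-map-*ʳ (λ d → indicator (h d)) Y domain) ⟩
    countTuples M (eval M G) (v ∷ []) s * X + countTuples M (eval M H) (v ∷ []) s * Y ∎
    where
    g h : Dom M → Bool
    g d = eval M G (s [ v ≔ d ])
    h d = eval M H (s [ v ≔ d ])

    summand : ∀ d → countTuples M (eval M (disj (conj G φ) (conj H ψ))) xs (s [ v ≔ d ])
                  ≡ indicator (g d) * X + indicator (h d) * Y
    summand d = begin
      countTuples M (eval M (disj (conj G φ) (conj H ψ))) xs (s [ v ≔ d ])
        ≡⟨ countTuples-freeze (eval M G) (λ b s' → (b ∧ eval M φ s') ∨ (eval M H s' ∧ eval M ψ s'))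
                              xs ignsG (s [ v ≔ d ]) ⟩
      countTuples M (λ s' → (g d ∧ eval M φ s') ∨ (eval M H s' ∧ eval M ψ s')) xs (s [ v ≔ d ])
        ≡⟨ countTuples-freeze (eval M H) (λ b s' → (g d ∧ eval M φ s') ∨ (b ∧ eval M ψ s'))
                              xs ignsH (s [ v ≔ d ]) ⟩
      countTuples M (λ s' → (g d ∧ eval M φ s') ∨ (h d ∧ eval M ψ s')) xs (s [ v ≔ d ])
        ≡⟨ countTuples-select (g d) (h d) (exclusive d) (eval M φ) (eval M ψ) xs (s [ v ≔ d ]) ⟩
      indicator (g d) * countTuples M (eval M φ) xs (s [ v ≔ d ])
        + indicator (h d) * countTuples M (eval M ψ) xs (s [ v ≔ d ])
        ≡⟨ cong₂ (λ x y → indicator (g d) * x + indicator (h d) * y) (φ≡X d) (ψ≡Y d) ⟩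
      indicator (g d) * X + indicator (h d) * Y ∎

  eval-equal-updated : ∀ v k s d → k ≢ v → eval M (equal v k) (s [ v ≔ d ]) ≡ ⌊ d ≟ᶠ s k ⌋
  eval-equal-updated v k s d k≢v = cong₂ (λ a b → ⌊ a ≟ᶠ b ⌋) (update-≡ s v d) (update-≢ s d k≢v)

  countTuples-equal : ∀ v k s → k ≢ v → countTuples M (eval M (equal v k)) (v ∷ []) s ≡ 1
  countTuples-equal v k s k≢v =
    trans (cong sum (map-cong (λ d → cong indicator (eval-equal-updated v k s d k≢v)) domain))
          (sum-indicator-≟ (s k))

  equal-exclusive : ∀ v s → 0 ≢ v → 1 ≢ v → s 0 ≢ s 1 →
    ∀ d → eval M (equal v 0) (s [ v ≔ d ]) ∧ eval M (equal v 1) (s [ v ≔ d ]) ≡ false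
  equal-exclusive v s 0≢v 1≢v s0≢s1 d =
    trans (cong₂ _∧_ (eval-equal-updated v 0 s d 0≢v) (eval-equal-updated v 1 s d 1≢v))
          (≟ᶠ-exclusive d (s 0) (s 1) s0≢s1)

  countTuples-stateDesc : ∀ J v s → countTuples M (eval M (stateDesc J v)) (v ∷ []) s ≡ card M J
  countTuples-stateDesc J v s = cong sum (map-cong same-point domain)
    where
    same-point : ∀ d → indicator (eval M (stateDesc J v) (s [ v ≔ d ]))
                     ≡ indicator (eval M (stateDesc J 0) ((λ _ → zero) [ 0 ≔ d ]))
    same-point d =
      cong indicator (local-stateDesc J (trans (update-≡ s v d) (sym (update-≡ (λ _ → zero) 0 d))))

infixr 6 _⊕_
infixr 7 _·_

data CountExpr (p : ℕ) : Set where
  𝟘 𝟙 : CountExpr p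
  _·_ : Subset p → CountExpr p → CountExpr p
  _⊕_ : CountExpr p → CountExpr p → CountExpr p

value : ∀ {p} → (Subset p → ℕ) → CountExpr p → ℕ
value c 𝟘        = 0
value c 𝟙        = 1
value c (J · e)  = c J * value c e
value c (e ⊕ e') = value c e + value c e'

depth : ∀ {p} → CountExpr p → ℕ
depth 𝟘        = 0
depth 𝟙        = 0
depth (J · e)  = suc (depth e)
depth (e ⊕ e') = suc (depth e ⊔ depth e')

varsFrom : Var → ℕ → List Var
varsFrom v zero    = []
varsFrom v (suc L) = v ∷ varsFrom (suc v) L

varsFrom-above : ∀ u L → Allˡ (u ≤_) (varsFrom u L)
varsFrom-above u zero    = []
varsFrom-above u (suc L) = ≤-refl ∷ Allˡ.map (≤-trans (n≤1+n u)) (varsFrom-above (suc u) L)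

-- The variables 0 and 1 hold two distinct elements a ≠ b. The tuples counted by encode e v L
-- range over the variables v, …, v + L - 1: a factor J · e spends one position on an element
-- of J, a sum e ⊕ e' spends one on the tag a or b choosing the summand, and 𝟙 pads the
-- remaining positions with a. With fewer than depth e positions the result is junk (⊥ᶠ).
encode : ∀ {p} → CountExpr p → Var → ℕ → Formula p
encode 𝟘        v L       = ⊥ᶠ
encode 𝟙        v zero    = ⊤ᶠ
encode 𝟙        v (suc L) = conj (equal v 0) (encode 𝟙 (suc v) L)
encode (J · e)  v zero    = ⊥ᶠ
encode (J · e)  v (suc L) = conj (stateDesc J v) (encode e (suc v) L)
encode (e ⊕ e') v zero    = ⊥ᶠ
encode (e ⊕ e') v (suc L) =
  disj (conj (equal v 0) (encode e (suc v) L)) (conj (equal v 1) (encode e' (suc v) L))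

fv-encode : ∀ {p} (e : CountExpr p) v L → Allˡ (λ y → y ∈ varsFrom v L ⊎ y < 2) (fv (encode e v L))
fv-encode 𝟘        v L       = []
fv-encode 𝟙        v zero    = []
fv-encode 𝟙        v (suc L) =
  inj₁ (here refl) ∷ inj₂ (s≤s z≤n) ∷ Allˡ.map (Sum.map₁ there) (fv-encode 𝟙 (suc v) L)
fv-encode (J · e)  v zero    = []
fv-encode (J · e)  v (suc L) =
  ++⁺ (Allˡ.map (inj₁ ∘ here) (fv-stateDesc J v)) (Allˡ.map (Sum.map₁ there) (fv-encode e (suc v) L))
fv-encode (e ⊕ e') v zero    = []
fv-encode (e ⊕ e') v (suc L) =
  ++⁺ (inj₁ (here refl) ∷ inj₂ (s≤s z≤n)       ∷ Allˡ.map (Sum.map₁ there) (fv-encode e  (suc v) L))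
      (inj₁ (here refl) ∷ inj₂ (s≤s (s≤s z≤n)) ∷ Allˡ.map (Sum.map₁ there) (fv-encode e' (suc v) L))

count≿-expr : ∀ {p} → CountExpr p → CountExpr p → Formula p
count≿-expr e e' =
  count≿ (varsFrom 2 (depth e)) (encode e 2 (depth e)) (varsFrom 2 (depth e')) (encode e' 2 (depth e'))

withDistinctTags : ∀ {p} → Formula p → Formula p
withDistinctTags φ = exists 0 (exists 1 (conj (neg (equal 0 1)) φ))

fv-withDistinctTags : ∀ {p} {φ : Formula p} → Allˡ (_< 2) (fv φ) → Closed (withDistinctTags φ)
fv-withDistinctTags fv<2 =
  All-remove 0 _ (Allˡ.map inj₁ (All-remove 1 _ (Allˡ.map (Sum.map₂ n<1⇒n≡0 ∘ swap ∘ m<1+n⇒m<n∨m≡n)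
    (s≤s z≤n ∷ s≤s (s≤s z≤n) ∷ fv<2))))

fv-count≿-expr : ∀ {p} (e e' : CountExpr p) → Allˡ (_< 2) (fv (count≿-expr e e'))
fv-count≿-expr e e' =
  ++⁺ (All-removeAll _ _ (fv-encode e 2 (depth e))) (All-removeAll _ _ (fv-encode e' 2 (depth e')))

module _ {p : ℕ} (M : Model p) where
  open Counting M

  private
    0≢ : ∀ {v} → 2 ≤ v → 0 ≢ v
    0≢ 2≤v = <⇒≢ (≤-trans (s≤s z≤n) 2≤v)

    1≢ : ∀ {v} → 2 ≤ v → 1 ≢ v
    1≢ 2≤v = <⇒≢ 2≤v

    ignores-equal-tag : ∀ {k v} L → k < 2 → 2 ≤ v →
      Allˡ (Ignores (eval M (equal v k))) (varsFrom (suc v) L)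
    ignores-equal-tag {k} {v} L k<2 2≤v = Allˡ.map ignores (varsFrom-above (suc v) L)
      where
      ignores : ∀ {w} → v < w → Ignores (eval M (equal v k)) w
      ignores v<w = ignores-equal (<⇒≢ v<w) (<⇒≢ (<-trans (≤-trans k<2 2≤v) v<w))

    tags-kept : ∀ {v} s d → 2 ≤ v → s 0 ≢ s 1 → (s [ v ≔ d ]) 0 ≢ (s [ v ≔ d ]) 1
    tags-kept s d 2≤v s0≢s1 s'0≡s'1 =
      s0≢s1 (trans (sym (update-≢ s d (0≢ 2≤v))) (trans s'0≡s'1 (update-≢ s d (1≢ 2≤v))))

  countTuples-encode : ∀ (e : CountExpr p) {v L} s → 2 ≤ v → depth e ≤ L → s 0 ≢ s 1 →
    countTuples M (eval M (encode e v L)) (varsFrom v L) s ≡ value (card M) e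
  countTuples-encode 𝟘 {v} {L} s _ _ _ = countTuples-false (varsFrom v L) s
  countTuples-encode 𝟙 {v} {zero} s _ _ _ = refl
  countTuples-encode 𝟙 {v} {suc L} s 2≤v _ s0≢s1 = begin
    countTuples M (eval M (encode 𝟙 v (suc L))) (varsFrom v (suc L)) s
      ≡⟨ countTuples-conj (equal v 0) (encode 𝟙 (suc v) L) v _ s
                          (ignores-equal-tag L (s≤s z≤n) 2≤v)
                          (λ d → countTuples-encode 𝟙 {L = L} (s [ v ≔ d ]) (m≤n⇒m≤1+n 2≤v) z≤n
                                                    (tags-kept s d 2≤v s0≢s1)) ⟩
    countTuples M (eval M (equal v 0)) (v ∷ []) s * 1
      ≡⟨ cong (_* 1) (countTuples-equal v 0 s (0≢ 2≤v)) ⟩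
    1 ∎
  countTuples-encode (J · e) {v} {suc L} s 2≤v (s≤s depth≤L) s0≢s1 = begin
    countTuples M (eval M (encode (J · e) v (suc L))) (varsFrom v (suc L)) s
      ≡⟨ countTuples-conj (stateDesc J v) (encode e (suc v) L) v _ s
                          (Allˡ.map (ignores-stateDesc J ∘ <⇒≢) (varsFrom-above (suc v) L))
                          (λ d → countTuples-encode e (s [ v ≔ d ]) (m≤n⇒m≤1+n 2≤v) depth≤L
                                                    (tags-kept s d 2≤v s0≢s1)) ⟩
    countTuples M (eval M (stateDesc J v)) (v ∷ []) s * value (card M) e
      ≡⟨ cong (_* value (card M) e) (countTuples-stateDesc J v s) ⟩
    card M J * value (card M) e ∎
  countTuples-encode (e ⊕ e') {v} {suc L} s 2≤v (s≤s depth≤L) s0≢s1 = begin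
    countTuples M (eval M (encode (e ⊕ e') v (suc L))) (varsFrom v (suc L)) s
      ≡⟨ countTuples-disj (equal v 0) (equal v 1) (encode e (suc v) L) (encode e' (suc v) L) v _ s
                          (ignores-equal-tag L (s≤s z≤n) 2≤v) (ignores-equal-tag L ≤-refl 2≤v)
                          (equal-exclusive v s (0≢ 2≤v) (1≢ 2≤v) s0≢s1)
                          (λ d → countTuples-encode e (s [ v ≔ d ]) (m≤n⇒m≤1+n 2≤v)
                                   (≤-trans (m≤m⊔n _ _) depth≤L) (tags-kept s d 2≤v s0≢s1))
                          (λ d → countTuples-encode e' (s [ v ≔ d ]) (m≤n⇒m≤1+n 2≤v)
                                   (≤-trans (m≤n⊔m _ _) depth≤L) (tags-kept s d 2≤v s0≢s1)) ⟩
    countTuples M (eval M (equal v 0)) (v ∷ []) s * value (card M) e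
      + countTuples M (eval M (equal v 1)) (v ∷ []) s * value (card M) e'
      ≡⟨ cong₂ (λ a b → a * value (card M) e + b * value (card M) e')
               (countTuples-equal v 0 s (0≢ 2≤v)) (countTuples-equal v 1 s (1≢ 2≤v)) ⟩
    1 * value (card M) e + 1 * value (card M) e'
      ≡⟨ cong₂ _+_ (*-identityˡ (value (card M) e)) (*-identityˡ (value (card M) e')) ⟩
    value (card M) e + value (card M) e' ∎

  eval-count≿-expr : ∀ (e e' : CountExpr p) s → s 0 ≢ s 1 →
    eval M (count≿-expr e e') s ≡ (value (card M) e' ≤ᵇ value (card M) e)
  eval-count≿-expr e e' s s0≢s1 =
    cong₂ _≤ᵇ_ (countTuples-encode e' s ≤-refl ≤-refl s0≢s1) (countTuples-encode e s ≤-refl ≤-refl s0≢s1)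

  withDistinctTags-sem : ∀ (φ : Formula p) b (c d : Dom M) → c ≢ d → (∀ s → s 0 ≢ s 1 → eval M φ s ≡ b) →
    ∀ s → T (eval M (withDistinctTags φ) s) ⇔ T b
  withDistinctTags-sem φ b c d c≢d φ≡b s = mk⇔ forward backward
    where
    forward : T (eval M (withDistinctTags φ) s) → T b
    forward holds with satisfied (any⁻ _ domain holds)
    ... | c' , holds' with satisfied (any⁻ _ domain holds')
    ... | d' , holds'' with to T-∧ holds''
    ... | c'≢d' , Tφ = subst T (φ≡b _ (toWitnessFalse c'≢d')) Tφ

    backward : T b → T (eval M (withDistinctTags φ) s)
    backward Tb = any⁺ _ (lose (∈-allFin c) (any⁺ _ (lose (∈-allFin d)
      (from T-∧ (fromWitnessFalse c≢d , subst T (sym (φ≡b _ c≢d)) Tb)))))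

times : ∀ {p} → ℕ → CountExpr p → CountExpr p
times zero    e = 𝟘
times (suc a) e = e ⊕ times a e

power : ∀ {p} → Subset p → ℕ → CountExpr p → CountExpr p
power J zero    e = e
power J (suc k) e = J · power J k e

monomialProduct : ∀ {p n} → (Fin n → Subset p) → Vec ℕ n → CountExpr p
monomialProduct S []ᵛ        = 𝟙
monomialProduct S (k ∷ᵛ ks) = power (S zero) k (monomialProduct (S ∘ suc) ks)

polynomialExpr : ∀ {p n k} → (Fin n → Subset p) → Vec (Monomial n) k → CountExpr p
polynomialExpr S []ᵛ        = 𝟘
polynomialExpr S (m ∷ᵛ ms) =
  times (Monomial.coeff m) (monomialProduct S (Monomial.exps m)) ⊕ polynomialExpr S ms

module _ {p : ℕ} (c : Subset p → ℕ) where

  value-times : ∀ a e → value c (times a e) ≡ a * value c e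
  value-times zero    e = refl
  value-times (suc a) e = cong (value c e +_) (value-times a e)

  value-power : ∀ J k e → value c (power J k e) ≡ c J ^ k * value c e
  value-power J zero    e = sym (*-identityˡ (value c e))
  value-power J (suc k) e = trans (cong (c J *_) (value-power J k e)) (sym (*-assoc (c J) _ _))

  value-monomialProduct : ∀ {n} (S : Fin n → Subset p) ks →
    value c (monomialProduct S ks) ≡ Vec.foldr _ _*_ 1 (Vec.tabulate (λ i → c (S i) ^ lookup ks i))
  value-monomialProduct S []ᵛ        = refl
  value-monomialProduct S (k ∷ᵛ ks) =
    trans (value-power (S zero) k _) (cong (c (S zero) ^ k *_) (value-monomialProduct (S ∘ suc) ks))

  value-polynomialExpr : ∀ {n k} (S : Fin n → Subset p) (ms : Vec (Monomial n) k) →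
    value c (polynomialExpr S ms) ≡ sumMon ms (λ i → c (S i))
  value-polynomialExpr S []ᵛ        = refl
  value-polynomialExpr S (m ∷ᵛ ms) = cong₂ _+_
    (trans (value-times (Monomial.coeff m) _)
           (cong (Monomial.coeff m *_) (value-monomialProduct S (Monomial.exps m))))
    (value-polynomialExpr S ms)

sumMon-cong : ∀ {n k} (ms : Vec (Monomial n) k) {v w : Fin n → ℕ} → (∀ i → v i ≡ w i) →
  sumMon ms v ≡ sumMon ms w
sumMon-cong []ᵛ        v≗w = refl
sumMon-cong (m ∷ᵛ ms) v≗w = cong₂ _+_
  (cong (λ xs → Monomial.coeff m * Vec.foldr _ _*_ 1 xs)
        (tabulate-cong (λ i → cong (_^ lookup (Monomial.exps m) i) (v≗w i))))
  (sumMon-cong ms v≗w)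

booleanCombination : ∀ {p} n → (Fin n → Formula p) → (Vec Bool n → Bool) → Formula p
booleanCombination zero    θ f = if f []ᵛ then ⊤ᶠ else ⊥ᶠ
booleanCombination (suc n) θ f =
  ite (θ zero) (booleanCombination n (θ ∘ suc) (f ∘ (true ∷ᵛ_)))
               (booleanCombination n (θ ∘ suc) (f ∘ (false ∷ᵛ_)))

fv-booleanCombination : ∀ {p} n (θ : Fin n → Formula p) f → (∀ i → Closed (θ i)) →
  Closed (booleanCombination n θ f)
fv-booleanCombination zero θ f closedθ with f []ᵛ
... | true  = []
... | false = []
fv-booleanCombination (suc n) θ f closedθ =
  fv-ite (θ zero) (booleanCombination n (θ ∘ suc) (f ∘ (true ∷ᵛ_)))
                  (booleanCombination n (θ ∘ suc) (f ∘ (false ∷ᵛ_)))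
         (closedθ zero)
         (fv-booleanCombination n (θ ∘ suc) (f ∘ (true ∷ᵛ_)) (closedθ ∘ suc))
         (fv-booleanCombination n (θ ∘ suc) (f ∘ (false ∷ᵛ_)) (closedθ ∘ suc))

eval-booleanCombination : ∀ {p} (M : Model p) n (θ : Fin n → Formula p) f s →
  eval M (booleanCombination n θ f) s ≡ f (Vec.tabulate (λ i → eval M (θ i) s))
eval-booleanCombination M zero θ f s with f []ᵛ
... | true  = refl
... | false = refl
eval-booleanCombination M (suc n) θ f s =
  trans (eval-ite M (θ zero) (booleanCombination n (θ ∘ suc) (f ∘ (true ∷ᵛ_)))
                              (booleanCombination n (θ ∘ suc) (f ∘ (false ∷ᵛ_))) s)
        (trans (if-cong₂ b (eval-booleanCombination M n (θ ∘ suc) (f ∘ (true ∷ᵛ_)) s)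
                           (eval-booleanCombination M n (θ ∘ suc) (f ∘ (false ∷ᵛ_)) s))
               (select b))
  where
  b = eval M (θ zero) s
  w = Vec.tabulate (λ i → eval M (θ (suc i)) s)

  select : ∀ b → (if b then f (true ∷ᵛ w) else f (false ∷ᵛ w)) ≡ f (b ∷ᵛ w)
  select true  = refl
  select false = refl

T-≤ᵇ : ∀ {m n} → T (m ≤ᵇ n) ⇔ m ≤ n
T-≤ᵇ = mk⇔ (≤ᵇ⇒≤ _ _) ≤⇒≤ᵇ

pointModel : ∀ {p} → (Fin p → Fin 1 → Bool) → Model p
pointModel I = record { size = 0 ; interp = I }

card-pointModel : ∀ {p} (I : Fin p → Fin 1 → Bool) J →
  card (pointModel I) J ≡ indicator (eval (pointModel I) (exists 0 (stateDesc J 0)) (λ _ → zero))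
card-pointModel I J =
  single (eval (pointModel I) (stateDesc J 0) (_[_↦_] {M = pointModel I} (λ _ → zero) 0 zero))
  where
  single : ∀ b → indicator b + 0 ≡ indicator (b ∨ false)
  single true  = refl
  single false = refl

module _ {p n k j : ℕ} (S : Fin n → Subset p) (lhs : Vec (Monomial n) k) (rhs : Vec (Monomial n) j) where

  private
    holdsAt : (Fin n → ℕ) → Bool
    holdsAt v = sumMon rhs v ≤ᵇ sumMon lhs v

    holdsOnBits : Vec Bool n → Bool
    holdsOnBits bits = holdsAt (indicator ∘ lookup bits)

    inhabited : Fin n → Formula p
    inhabited i = exists 0 (stateDesc (S i) 0)

    comparison : Formula p
    comparison = count≿-expr (polynomialExpr S lhs) (polynomialExpr S rhs)

    singleton onePointCase twoPointCase : Formula p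
    singleton    = all∀ 0 (all∀ 1 (equal 0 1))
    onePointCase = booleanCombination n inhabited holdsOnBits
    twoPointCase = withDistinctTags comparison

  diophantineSentence : Formula p
  diophantineSentence = ite singleton onePointCase twoPointCase

  diophantineSentence-closed : Sentence diophantineSentence
  diophantineSentence-closed = Closed⇒Sentence {φ = diophantineSentence}
    (fv-ite singleton onePointCase twoPointCase []
      (fv-booleanCombination n inhabited holdsOnBits
        (λ i → All-remove 0 _ (Allˡ.map inj₁ (fv-stateDesc (S i) 0))))
      (fv-withDistinctTags {φ = comparison}
        (fv-count≿-expr (polynomialExpr S lhs) (polynomialExpr S rhs))))

  -- singleton evaluates by computation: to true in a one-point model, to false otherwise.
  private
    onePoint-eval : ∀ I →
      eval (pointModel I) diophantineSentence (λ _ → zero) ≡ holdsAt (λ i → card (pointModel I) (S i))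
    onePoint-eval I = begin
      eval M diophantineSentence s₀
        ≡⟨ eval-ite M singleton onePointCase twoPointCase s₀ ⟩
      eval M onePointCase s₀
        ≡⟨ eval-booleanCombination M n inhabited holdsOnBits s₀ ⟩
      holdsAt (λ i → indicator (lookup (Vec.tabulate (λ i → eval M (inhabited i) s₀)) i))
        ≡⟨ cong₂ _≤ᵇ_ (sumMon-cong rhs bit≡card) (sumMon-cong lhs bit≡card) ⟩
      holdsAt (λ i → card M (S i)) ∎
      where
      M = pointModel I
      s₀ : Assignment M
      s₀ = λ _ → zero
      bit≡card : ∀ i → indicator (lookup (Vec.tabulate (λ i → eval M (inhabited i) s₀)) i) ≡ card M (S i)
      bit≡card i = trans (cong indicator (lookup∘tabulate _ i)) (sym (card-pointModel I (S i)))

    twoPoint-eval : ∀ (M : Model p) s → s 0 ≢ s 1 → eval M comparison s ≡ holdsAt (λ i → card M (S i))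
    twoPoint-eval M s s0≢s1 =
      trans (eval-count≿-expr M (polynomialExpr S lhs) (polynomialExpr S rhs) s s0≢s1)
            (cong₂ _≤ᵇ_ (value-polynomialExpr (card M) S rhs) (value-polynomialExpr (card M) S lhs))

  diophantineSentence-sem : (M : Model p) →
    (M ⊨ diophantineSentence) ⇔ (sumMon rhs (λ i → card M (S i)) ≤ sumMon lhs (λ i → card M (S i)))
  diophantineSentence-sem record { size = zero ; interp = I } =
    ⇔-trans (mk⇔ (trans (sym (onePoint-eval I))) (trans (onePoint-eval I))) (⇔-trans (⇔-sym T-≡) T-≤ᵇ)
  diophantineSentence-sem M@record { size = suc m } =
    ⇔-trans (⇔-sym T-≡) (⇔-trans (withDistinctTags-sem M comparison (holdsAt (λ i → card M (S i)))
                                   zero (suc zero) (λ ()) (twoPoint-eval M) (λ _ → zero)) T-≤ᵇ)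

-- Neither the distinctness of the state-descriptions, nor the positivity of the coefficients,
-- nor the non-emptiness of the two sides is needed.
lemma5p4 : (p n k j : ℕ) (S : Fin n → Subset p)
    → (∀ a b → S a ≡ S b → a ≡ b)
    → (lhs : Vec (Monomial n) (suc k)) (rhs : Vec (Monomial n) (suc j))
    → All (λ m → 0 < Monomial.coeff m) lhs
    → All (λ m → 0 < Monomial.coeff m) rhs
    → Σ (Formula p) (λ φ → Sentence φ ×
        ((M : Model p) → (M ⊨ φ) ⇔
          (sumMon rhs (λ i → card M (S i)) ≤ sumMon lhs (λ i → card M (S i)))))
lemma5p4 p n k j S _ lhs rhs _ _ =
  diophantineSentence S lhs rhs ,
  diophantineSentence-closed S lhs rhs ,
  diophantineSentence-sem S lhs rhs
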